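{- Let $u_0\geq 1$ and $r\geq 2$ be integers with $\gcd(u_0,r)=1$, let $n\geq 0$ be an integer, and set $u_j:=u_0+jr$ for $0\leq j\leq n$ and $L_n:=\operatorname{lcm}(u_0,u_1,\ldots,u_n)$. Then $$L_n \geq r^{\frac{nr}{r-1}}\binom{\frac{u_0}{r}+n}{n+1}.$$
   Context: For a real number $x$ and an integer $N\geq 0$, the binomial coefficient is defined by $\binom{x}{N}:=\frac{x(x-1)\cdots(x-N+1)}{N!}$ (so it may be applied with non-integer $x$). -}

module Defs where

open import Data.Nat using (ℕ; zero; suc; _+_; _*_; _!)
open import Data.Nat.Properties using (_!≢0)
open import Data.Nat.LCM using (lcm)
open import Data.Integer using (+_)
open import Data.Rational as ℚ using (ℚ; _/_; 1ℚ)

ℕ→ℚ : ℕ → ℚ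
ℕ→ℚ k = (+ k) / 1

_^ℚ_ : ℚ → ℕ → ℚ
q ^ℚ zero = 1ℚ
q ^ℚ suc k = q ℚ.* (q ^ℚ k)

falling : ℚ → ℕ → ℚ
falling x zero = 1ℚ
falling x (suc N) = falling x N ℚ.* (x ℚ.- ℕ→ℚ N)

binom : ℚ → ℕ → ℚ
binom x N = falling x N ℚ.* ((+ 1 / (N !)) {{N !≢0}})

u : ℕ → ℕ → ℕ → ℕ
u u0 r j = u0 + j * r

L : ℕ → ℕ → ℕ → ℕ
L u0 r zero = u u0 r 0
L u0 r (suc n) = lcm (L u0 r n) (u u0 r (suc n))

module Submission where

-- Each u_j divides L_n, and an induction on n gives u_0 u_1 ⋯ u_n ∣ n! rⁿ L_n. Every u_j is prime
-- to r, so the power r^v dividing n! can be cancelled: u_0 ⋯ u_n ≤ (n! / r^v) L_n. Legendre's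
-- argument, which works for any base r ≥ 2, makes r^v large: rⁿ ≤ (r^v · r (n+1))^(r-1). Finally
-- binom(u_0/r + n, n+1) = u_0 ⋯ u_n / (r^(n+1) (n+1)!), so after raising to the power r - 1 and
-- clearing denominators the claim becomes an inequality between natural numbers.

open import Defs

module OnNaturals where

  open import Data.Nat
  open import Data.Nat.Properties
  open import Data.Nat.Divisibility
  open import Data.Nat.DivMod
  open import Data.Nat.GCD using (gcd)
  open import Data.Nat.LCM using (lcm; m∣lcm[m,n]; n∣lcm[m,n]; gcd*lcm)
  open import Data.Nat.Coprimality as Coprime using (Coprime)
  open import Data.Nat.Induction using (<-rec)
  open import Data.Nat.Tactic.RingSolver using (solve-∀)
  open import Data.Product using (Σ-syntax; _×_; _,_)
  open import Data.Sum using (_⊎_; inj₁; inj₂; [_,_]′)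
  open import Relation.Binary.PropositionalEquality
  import Algebra.Properties.CommutativeSemigroup as CommSemigroupProperties

  ∏u : ℕ → ℕ → ℕ → ℕ
  ∏u u0 r zero = u u0 r 0
  ∏u u0 r (suc n) = u u0 r (suc n) * ∏u u0 r n

  u∣L : ∀ u0 r {j n} → j ≤ n → u u0 r j ∣ L u0 r n
  u∣L u0 r {n = zero} z≤n = ∣-refl
  u∣L u0 r {j} {suc n} j≤1+n with m≤n⇒m<n∨m≡n j≤1+n
  ... | inj₁ j<1+n = ∣-trans (u∣L u0 r (≤-pred j<1+n)) (m∣lcm[m,n] (L u0 r n) _)
  ... | inj₂ refl = n∣lcm[m,n] (L u0 r n) _

  u-shift : ∀ u0 r j → u (u0 + r) r j ≡ u u0 r (suc j)
  u-shift u0 r j = +-assoc u0 r (j * r)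

  ∏u-shift : ∀ u0 r n → u0 * ∏u (u0 + r) r n ≡ ∏u u0 r (suc n)
  ∏u-shift u0 r zero = trans (*-comm u0 _) (cong₂ _*_ (u-shift u0 r 0) (sym (+-identityʳ u0)))
  ∏u-shift u0 r (suc n) = begin
    u0 * (u′ (suc n) * ∏u′ n)          ≡⟨ x∙yz≈y∙xz u0 (u′ (suc n)) (∏u′ n) ⟩
    u′ (suc n) * (u0 * ∏u′ n)          ≡⟨ cong₂ _*_ (u-shift u0 r (suc n)) (∏u-shift u0 r n) ⟩
    u u0 r (2 + n) * ∏u u0 r (suc n)   ∎
    where
    open ≡-Reasoning
    open CommSemigroupProperties *-commutativeSemigroup
    u′ ∏u′ : ℕ → ℕ
    u′ = u (u0 + r) r
    ∏u′ = ∏u (u0 + r) r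

  -- The two inductive hypotheses are for u_0, …, u_n and for u_1, …, u_{n+1};
  -- their difference u_{n+1} - u_0 = (n+1) r supplies the extra factor (n+1) r.
  ∏u∣n!*r^n*M : ∀ u0 r n {M} → (∀ {j} → j ≤ n → u u0 r j ∣ M) → ∏u u0 r n ∣ n ! * r ^ n * M
  ∏u∣n!*r^n*M u0 r zero {M} u∣M = subst (_ ∣_) (sym (+-identityʳ M)) (u∣M z≤n)
  ∏u∣n!*r^n*M u0 r (suc n) {M} u∣M =
    ∣m+n∣m⇒∣n (subst (∏u u0 r (suc n) ∣_) expand ∏u∣u[1+n]*X) ∏u∣u0*X
    where
    X : ℕ
    X = n ! * r ^ n * M
    ∏u∣u[1+n]*X : ∏u u0 r (suc n) ∣ u u0 r (suc n) * X
    ∏u∣u[1+n]*X = *-monoʳ-∣ (u u0 r (suc n)) (∏u∣n!*r^n*M u0 r n (λ j≤n → u∣M (m≤n⇒m≤1+n j≤n)))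
    u′∣M : ∀ {j} → j ≤ n → u (u0 + r) r j ∣ M
    u′∣M {j} j≤n = subst (_∣ M) (sym (u-shift u0 r j)) (u∣M (s≤s j≤n))
    ∏u∣u0*X : ∏u u0 r (suc n) ∣ u0 * X
    ∏u∣u0*X = subst (_∣ u0 * X) (∏u-shift u0 r n) (*-monoʳ-∣ u0 (∏u∣n!*r^n*M (u0 + r) r n u′∣M))
    expand : u u0 r (suc n) * X ≡ u0 * X + suc n ! * r ^ suc n * M
    expand = lemma (n !) (r ^ n) M u0 r n
      where
      lemma : ∀ f p m a b k →
        (a + (b + k * b)) * (f * p * m) ≡ a * (f * p * m) + (f + k * f) * (b * p) * m
      lemma = solve-∀

  coprime-*ˡ : ∀ {m n o} → Coprime m o → Coprime n o → Coprime (m * n) o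
  coprime-*ˡ {m} m⊥o n⊥o (d∣mn , d∣o) = n⊥o (Coprime.coprime-divisor d⊥m d∣mn , d∣o)
    where
    d⊥m : Coprime _ m
    d⊥m (e∣d , e∣m) = m⊥o (e∣m , ∣-trans e∣d d∣o)

  coprime-^ˡ : ∀ {m n} k → Coprime m n → Coprime (m ^ k) n
  coprime-^ˡ {n = n} zero _ = Coprime.1-coprimeTo n
  coprime-^ˡ (suc k) m⊥n = coprime-*ˡ m⊥n (coprime-^ˡ k m⊥n)

  coprime-u : ∀ {u0 r} → Coprime u0 r → ∀ j → Coprime (u u0 r j) r
  coprime-u {u0} u0⊥r zero = subst (λ x → Coprime x _) (sym (+-identityʳ u0)) u0⊥r
  coprime-u {u0} {r} u0⊥r (suc j) =
    subst (λ x → Coprime x r) (x∙yz≈y∙xz r u0 (j * r)) (Coprime.coprime-+ (coprime-u u0⊥r j))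
    where
    open CommSemigroupProperties +-commutativeSemigroup

  coprime-∏u : ∀ {u0 r} → Coprime u0 r → ∀ n → Coprime (∏u u0 r n) r
  coprime-∏u u0⊥r zero = coprime-u u0⊥r 0
  coprime-∏u u0⊥r (suc n) = coprime-*ˡ (coprime-u u0⊥r (suc n)) (coprime-∏u u0⊥r n)

  lcm-nonZero : ∀ m n .{{_ : NonZero m}} .{{_ : NonZero n}} → NonZero (lcm m n)
  lcm-nonZero m n = ≢-nonZero λ lcm≡0 → ≢-nonZero⁻¹ (m * n) {{m*n≢0 m n}}
    (trans (sym (gcd*lcm m n)) (trans (cong (gcd m n *_) lcm≡0) (*-zeroʳ (gcd m n))))

  L-nonZero : ∀ u0 r n .{{_ : NonZero u0}} → NonZero (L u0 r n)
  L-nonZero u0@(suc _) r zero = _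
  L-nonZero u0@(suc _) r (suc n) = lcm-nonZero (L u0 r n) (u u0 r (suc n)) {{L-nonZero u0 r n}}

  ∏u∣a*L : ∀ u0 r n {a v} → Coprime u0 r → n ! ≡ a * r ^ v → ∏u u0 r n ∣ a * L u0 r n
  ∏u∣a*L u0 r n {a} {v} u0⊥r n!≡a*r^v =
    Coprime.coprime-divisor (Coprime.sym (coprime-^ˡ (v + n) (Coprime.sym (coprime-∏u u0⊥r n))))
      (subst (∏u u0 r n ∣_) regroup (∏u∣n!*r^n*M u0 r n (u∣L u0 r)))
    where
    regroup : n ! * r ^ n * L u0 r n ≡ r ^ (v + n) * (a * L u0 r n)
    regroup = begin
      n ! * r ^ n * L u0 r n            ≡⟨ cong (λ f → f * r ^ n * L u0 r n) n!≡a*r^v ⟩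
      a * r ^ v * r ^ n * L u0 r n      ≡⟨ lemma a (r ^ v) (r ^ n) (L u0 r n) ⟩
      r ^ v * r ^ n * (a * L u0 r n)    ≡⟨ cong (_* (a * L u0 r n)) (^-distribˡ-+-* r v n) ⟨
      r ^ (v + n) * (a * L u0 r n)      ∎
      where
      open ≡-Reasoning
      lemma : ∀ a x y l → a * x * y * l ≡ x * y * (a * l)
      lemma = solve-∀

  k!*r^k∣[k*r]! : ∀ m k → k ! * suc m ^ k ∣ (k * suc m) !
  k!*r^k∣[k*r]! m zero = ∣-refl
  k!*r^k∣[k*r]! m (suc k) =
    subst₂ _∣_ (lemma (k !) (suc m ^ k) m k) (*-comm ((m + k * suc m) !) _)
      (*-monoˡ-∣ (suc (m + k * suc m)) (∣-trans (k!*r^k∣[k*r]! m k) (m≤n⇒m!∣n! (m≤n+m _ m))))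
    where
    lemma : ∀ f p m k → f * p * (1 + (m + k * (1 + m))) ≡ (f + k * f) * ((1 + m) * p)
    lemma = solve-∀

  -- v plays the role of Legendre's sum Σᵢ ⌊n/rⁱ⌋ and e that of the number of base-r digits of n,
  -- so that (r - 1) v = n - (digit sum of n) ≥ n - (r - 1) e.
  LegendreWitness : ℕ → ℕ → Set
  LegendreWitness m n = Σ[ v ∈ ℕ ] Σ[ e ∈ ℕ ]
    suc m ^ v ∣ n ! × n ≤ (v + e) * m × (e ≡ 0 ⊎ suc m ^ e ≤ suc m * n)

  legendreWitness : ∀ m → 1 ≤ m → ∀ n → LegendreWitness m n
  legendreWitness m m≥1 = <-rec (LegendreWitness m) step
    where
    r : ℕ
    r = suc m
    step : ∀ n → (∀ {k} → k < n → LegendreWitness m k) → LegendreWitness m n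
    step zero _ = 0 , 0 , ∣-refl , z≤n , inj₁ refl
    step n@(suc _) rec with v , e , r^v∣k! , k≤[v+e]*m , e-bound ← rec (m/n<m n r (s≤s m≥1)) =
      v + k , suc e , r^[v+k]∣n! , n≤[v+k+1+e]*m , inj₂ r^[1+e]≤r*n
      where
      k : ℕ
      k = n / r
      r*k≤n : r * k ≤ n
      r*k≤n = subst (_≤ n) (*-comm k r) (m/n*n≤m n r)
      r^[v+k]∣n! : r ^ (v + k) ∣ n !
      r^[v+k]∣n! = subst (_∣ n !) (sym (^-distribˡ-+-* r v k))
        (∣-trans (*-monoˡ-∣ (r ^ k) r^v∣k!)
          (∣-trans (k!*r^k∣[k*r]! m k) (m≤n⇒m!∣n! (m/n*n≤m n r))))
      n≤[v+k+1+e]*m : n ≤ (v + k + suc e) * m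
      n≤[v+k+1+e]*m = begin
        n                          ≡⟨ m≡m%n+[m/n]*n n r ⟩
        n % r + k * r              ≡⟨ cong (n % r +_) (*-suc k m) ⟩
        n % r + (k + k * m)        ≤⟨ +-mono-≤ (≤-pred (m%n<n n r)) (+-monoˡ-≤ (k * m) k≤[v+e]*m) ⟩
        m + ((v + e) * m + k * m)  ≡⟨ lemma m v e k ⟩
        (v + k + suc e) * m        ∎
        where
        open ≤-Reasoning
        lemma : ∀ m v e k → m + ((v + e) * m + k * m) ≡ (v + k + (1 + e)) * m
        lemma = solve-∀
      r^[1+e]≤r*n : r ^ suc e ≤ r * n
      r^[1+e]≤r*n = [ (λ e≡0 → subst (λ x → r ^ suc x ≤ r * n) (sym e≡0) (*-monoʳ-≤ r (s≤s z≤n)))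
                    , (λ r^e≤r*k → *-monoʳ-≤ r (≤-trans r^e≤r*k r*k≤n)) ]′ e-bound

  r-power∣n!-bound : ∀ m → 1 ≤ m → ∀ n →
    Σ[ v ∈ ℕ ] suc m ^ v ∣ n ! × suc m ^ n ≤ (suc m ^ v * (suc m * suc n)) ^ m
  r-power∣n!-bound m m≥1 n with v , e , r^v∣n! , n≤[v+e]*m , e-bound ← legendreWitness m m≥1 n =
    v , r^v∣n! , (begin
      r ^ n                      ≤⟨ ^-monoʳ-≤ r n≤[v+e]*m ⟩
      r ^ ((v + e) * m)          ≡⟨ ^-*-assoc r (v + e) m ⟨
      (r ^ (v + e)) ^ m          ≡⟨ cong (_^ m) (^-distribˡ-+-* r v e) ⟩
      (r ^ v * r ^ e) ^ m        ≤⟨ ^-monoˡ-≤ m (*-monoʳ-≤ (r ^ v) r^e≤r*[1+n]) ⟩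
      (r ^ v * (r * suc n)) ^ m  ∎)
    where
    open ≤-Reasoning
    r : ℕ
    r = suc m
    r^e≤r*[1+n] : r ^ e ≤ r * suc n
    r^e≤r*[1+n] = [ (λ e≡0 → subst (λ x → r ^ x ≤ r * suc n) (sym e≡0) (s≤s z≤n))
                  , (λ r^e≤r*n → ≤-trans r^e≤r*n (*-monoʳ-≤ r (n≤1+n n))) ]′ e-bound

  ^-distribʳ-* : ∀ m n k → (m * n) ^ k ≡ m ^ k * n ^ k
  ^-distribʳ-* m n zero = refl
  ^-distribʳ-* m n (suc k) = trans (cong (m * n *_) (^-distribʳ-* m n k)) (interchange m n (m ^ k) (n ^ k))
    where
    open CommSemigroupProperties *-commutativeSemigroup

  ∏u-lcm-bound : ∀ u0 m n .{{_ : NonZero u0}} → 1 ≤ m → Coprime u0 (suc m) →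
    suc m ^ (n * suc m) * ∏u u0 (suc m) n ^ m ≤ (L u0 (suc m) n * (suc m ^ suc n * suc n !)) ^ m
  ∏u-lcm-bound u0 m n m≥1 u0⊥r
    with v , divides a n!≡a*r^v , r^n≤Q^m ← r-power∣n!-bound m m≥1 n = begin
    r ^ (n * r) * P ^ m                      ≡⟨ cong (_* P ^ m) r^[n*r]≡r^n*[r^n]^m ⟩
    r ^ n * (r ^ n) ^ m * P ^ m              ≤⟨ *-monoˡ-≤ (P ^ m) (*-monoˡ-≤ ((r ^ n) ^ m) r^n≤Q^m) ⟩
    Q ^ m * (r ^ n) ^ m * P ^ m              ≤⟨ *-monoʳ-≤ (Q ^ m * (r ^ n) ^ m) (^-monoˡ-≤ m P≤a*L) ⟩
    Q ^ m * (r ^ n) ^ m * (a * L′) ^ m       ≡⟨ distrib ⟨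
    (Q * r ^ n * (a * L′)) ^ m               ≡⟨ cong (_^ m) regroup ⟩
    (L′ * (r ^ suc n * suc n !)) ^ m         ∎
    where
    open ≤-Reasoning
    r P L′ Q : ℕ
    r = suc m
    P = ∏u u0 r n
    L′ = L u0 r n
    Q = r ^ v * (r * suc n)
    P≤a*L : P ≤ a * L′
    P≤a*L = ∣⇒≤ {{m*n≢0 a L′ {{a≢0}} {{L-nonZero u0 r n}}}}
      (∏u∣a*L u0 r n {a} {v} u0⊥r n!≡a*r^v)
      where
      a≢0 : NonZero a
      a≢0 = m*n≢0⇒m≢0 a {{subst NonZero n!≡a*r^v (n !≢0)}}
    r^[n*r]≡r^n*[r^n]^m : r ^ (n * r) ≡ r ^ n * (r ^ n) ^ m
    r^[n*r]≡r^n*[r^n]^m = begin-equality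
      r ^ (n * r)          ≡⟨ cong (r ^_) (*-suc n m) ⟩
      r ^ (n + n * m)      ≡⟨ ^-distribˡ-+-* r n (n * m) ⟩
      r ^ n * r ^ (n * m)  ≡⟨ cong (r ^ n *_) (^-*-assoc r n m) ⟨
      r ^ n * (r ^ n) ^ m  ∎
    distrib : (Q * r ^ n * (a * L′)) ^ m ≡ Q ^ m * (r ^ n) ^ m * (a * L′) ^ m
    distrib = trans (^-distribʳ-* (Q * r ^ n) (a * L′) m)
      (cong (_* (a * L′) ^ m) (^-distribʳ-* Q (r ^ n) m))
    regroup : Q * r ^ n * (a * L′) ≡ L′ * (r ^ suc n * suc n !)
    regroup = trans (lemma (r ^ v) r n (r ^ n) a L′)
      (cong (λ f → L′ * (r ^ suc n * (suc n * f))) (sym n!≡a*r^v))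
      where
      lemma : ∀ x r n y a l → x * (r * (1 + n)) * y * (a * l) ≡ l * (r * y * ((1 + n) * (a * x)))
      lemma = solve-∀

module OnRationals where

  open OnNaturals using (∏u)
  open import Data.Nat as ℕ using (ℕ; zero; suc; _^_; _!; NonZero)
  import Data.Nat.Properties as ℕP
  open import Data.Integer as ℤ using (+_)
  import Data.Integer.Properties as ℤP
  open import Data.Rational as ℚ using (ℚ; _/_; _+_; _*_; _-_; _≤_; 0ℚ; 1ℚ; fromℚᵘ; toℚᵘ; Positive)
  import Data.Rational.Properties as ℚP
  open import Data.Rational.Unnormalised as ℚᵘ using (mkℚᵘ; *≡*)
  import Data.Rational.Unnormalised.Properties as ℚᵘP
  open import Data.Rational.Solver using (module +-*-Solver)
  open import Algebra.Bundles using (CommutativeMonoid)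
  import Algebra.Properties.CommutativeSemigroup as CommSemigroupProperties
  open import Relation.Binary.PropositionalEquality

  open CommSemigroupProperties (CommutativeMonoid.commutativeSemigroup ℚP.*-1-commutativeMonoid)
    using (interchange; xy∙z≈xz∙y)
  open +-*-Solver using (solve; _:+_; _:*_; _:-_; _:=_; con)

  fromℚᵘ-homo-+ : ∀ p q → fromℚᵘ (p ℚᵘ.+ q) ≡ fromℚᵘ p + fromℚᵘ q
  fromℚᵘ-homo-+ p q = ℚP.toℚᵘ-injective (begin-equality
    toℚᵘ (fromℚᵘ (p ℚᵘ.+ q))              ≃⟨ ℚP.toℚᵘ-fromℚᵘ (p ℚᵘ.+ q) ⟩
    p ℚᵘ.+ q                              ≃⟨ ℚᵘP.+-cong (ℚP.toℚᵘ-fromℚᵘ p) (ℚP.toℚᵘ-fromℚᵘ q) ⟨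
    toℚᵘ (fromℚᵘ p) ℚᵘ.+ toℚᵘ (fromℚᵘ q)  ≃⟨ ℚP.toℚᵘ-homo-+ (fromℚᵘ p) (fromℚᵘ q) ⟨
    toℚᵘ (fromℚᵘ p + fromℚᵘ q)            ∎)
    where
    open ℚᵘP.≤-Reasoning

  fromℚᵘ-homo-* : ∀ p q → fromℚᵘ (p ℚᵘ.* q) ≡ fromℚᵘ p * fromℚᵘ q
  fromℚᵘ-homo-* p q = ℚP.toℚᵘ-injective (begin-equality
    toℚᵘ (fromℚᵘ (p ℚᵘ.* q))              ≃⟨ ℚP.toℚᵘ-fromℚᵘ (p ℚᵘ.* q) ⟩
    p ℚᵘ.* q                              ≃⟨ ℚᵘP.*-cong (ℚP.toℚᵘ-fromℚᵘ p) (ℚP.toℚᵘ-fromℚᵘ q) ⟨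
    toℚᵘ (fromℚᵘ p) ℚᵘ.* toℚᵘ (fromℚᵘ q)  ≃⟨ ℚP.toℚᵘ-homo-* (fromℚᵘ p) (fromℚᵘ q) ⟨
    toℚᵘ (fromℚᵘ p * fromℚᵘ q)            ∎)
    where
    open ℚᵘP.≤-Reasoning

  -- ℕ→ℚ k and (+ a) / suc d reduce to fromℚᵘ (mkℚᵘ (+ k) 0) and fromℚᵘ (mkℚᵘ (+ a) d).
  ℕ→ℚ-+ : ∀ a b → ℕ→ℚ (a ℕ.+ b) ≡ ℕ→ℚ a + ℕ→ℚ b
  ℕ→ℚ-+ a b = trans
    (ℚP.fromℚᵘ-cong {mkℚᵘ (+ (a ℕ.+ b)) 0} {mkℚᵘ (+ a) 0 ℚᵘ.+ mkℚᵘ (+ b) 0}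
      (*≡* (cong (ℤ._* + 1) numerators)))
    (fromℚᵘ-homo-+ (mkℚᵘ (+ a) 0) (mkℚᵘ (+ b) 0))
    where
    numerators : + (a ℕ.+ b) ≡ + a ℤ.* + 1 ℤ.+ + b ℤ.* + 1
    numerators = trans (ℤP.pos-+ a b) (sym (cong₂ ℤ._+_ (ℤP.*-identityʳ (+ a)) (ℤP.*-identityʳ (+ b))))

  ℕ→ℚ-* : ∀ a b → ℕ→ℚ (a ℕ.* b) ≡ ℕ→ℚ a * ℕ→ℚ b
  ℕ→ℚ-* a b = trans
    (ℚP.fromℚᵘ-cong {mkℚᵘ (+ (a ℕ.* b)) 0} {mkℚᵘ (+ a) 0 ℚᵘ.* mkℚᵘ (+ b) 0}
      (*≡* (cong (ℤ._* + 1) (ℤP.pos-* a b))))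
    (fromℚᵘ-homo-* (mkℚᵘ (+ a) 0) (mkℚᵘ (+ b) 0))

  ℕ→ℚ-*-/ : ∀ d a .{{_ : NonZero d}} → ℕ→ℚ d * ((+ a) / d) ≡ ℕ→ℚ a
  ℕ→ℚ-*-/ (suc d) a = trans
    (sym (fromℚᵘ-homo-* (mkℚᵘ (+ suc d) 0) (mkℚᵘ (+ a) d)))
    (ℚP.fromℚᵘ-cong {mkℚᵘ (+ suc d) 0 ℚᵘ.* mkℚᵘ (+ a) d} {mkℚᵘ (+ a) 0} (*≡* cross-multiplied))
    where
    cross-multiplied : + suc d ℤ.* + a ℤ.* + 1 ≡ + a ℤ.* + suc (d ℕ.+ 0)
    cross-multiplied = begin
      + suc d ℤ.* + a ℤ.* + 1   ≡⟨ ℤP.*-identityʳ (+ suc d ℤ.* + a) ⟩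
      + suc d ℤ.* + a           ≡⟨ ℤP.*-comm (+ suc d) (+ a) ⟩
      + a ℤ.* + suc d           ≡⟨ cong (λ k → + a ℤ.* + suc k) (ℕP.+-identityʳ d) ⟨
      + a ℤ.* + suc (d ℕ.+ 0)   ∎
      where
      open ≡-Reasoning

  ℕ→ℚ-^ : ∀ a k → ℕ→ℚ (a ^ k) ≡ ℕ→ℚ a ^ℚ k
  ℕ→ℚ-^ a zero = refl
  ℕ→ℚ-^ a (suc k) = trans (ℕ→ℚ-* a (a ^ k)) (cong (ℕ→ℚ a *_) (ℕ→ℚ-^ a k))

  ℕ→ℚ-mono-≤ : ∀ {a b} → a ℕ.≤ b → ℕ→ℚ a ≤ ℕ→ℚ b
  ℕ→ℚ-mono-≤ {a} {b} a≤b = begin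
    ℕ→ℚ a                    ≡⟨ ℚP.+-identityʳ (ℕ→ℚ a) ⟨
    ℕ→ℚ a + 0ℚ               ≤⟨ ℚP.+-monoʳ-≤ (ℕ→ℚ a) (ℚP.nonNegative⁻¹ _ {{ℚP.normalize-nonNeg (b ℕ.∸ a) 1}}) ⟩
    ℕ→ℚ a + ℕ→ℚ (b ℕ.∸ a)    ≡⟨ ℕ→ℚ-+ a (b ℕ.∸ a) ⟨
    ℕ→ℚ (a ℕ.+ (b ℕ.∸ a))    ≡⟨ cong ℕ→ℚ (ℕP.m+[n∸m]≡n a≤b) ⟩
    ℕ→ℚ b                    ∎
    where
    open ℚP.≤-Reasoning

  ℕ→ℚ-pos : ∀ c .{{_ : NonZero c}} → Positive (ℕ→ℚ c)
  ℕ→ℚ-pos (suc c) = ℚP.normalize-pos (suc c) 1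

  ℕ→ℚ-cancelʳ-≤ : ∀ {x} a b c .{{_ : NonZero c}} → x * ℕ→ℚ c ≡ ℕ→ℚ a → a ℕ.≤ b ℕ.* c → x ≤ ℕ→ℚ b
  ℕ→ℚ-cancelʳ-≤ {x} a b c x*c≡a a≤b*c = ℚP.*-cancelʳ-≤-pos (ℕ→ℚ c) {{ℕ→ℚ-pos c}} (begin
    x * ℕ→ℚ c        ≡⟨ x*c≡a ⟩
    ℕ→ℚ a            ≤⟨ ℕ→ℚ-mono-≤ a≤b*c ⟩
    ℕ→ℚ (b ℕ.* c)    ≡⟨ ℕ→ℚ-* b c ⟩
    ℕ→ℚ b * ℕ→ℚ c    ∎)
    where
    open ℚP.≤-Reasoning

  ^ℚ-distrib-* : ∀ p q k → (p * q) ^ℚ k ≡ p ^ℚ k * q ^ℚ k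
  ^ℚ-distrib-* p q zero = refl
  ^ℚ-distrib-* p q (suc k) =
    trans (cong (p * q *_) (^ℚ-distrib-* p q k)) (interchange p q (p ^ℚ k) (q ^ℚ k))

  ^ℚ-scaling : ∀ {y} a c k → y * ℕ→ℚ c ≡ ℕ→ℚ a → y ^ℚ k * ℕ→ℚ (c ^ k) ≡ ℕ→ℚ (a ^ k)
  ^ℚ-scaling {y} a c k y*c≡a = begin
    y ^ℚ k * ℕ→ℚ (c ^ k)   ≡⟨ cong (y ^ℚ k *_) (ℕ→ℚ-^ c k) ⟩
    y ^ℚ k * ℕ→ℚ c ^ℚ k    ≡⟨ ^ℚ-distrib-* y (ℕ→ℚ c) k ⟨
    (y * ℕ→ℚ c) ^ℚ k       ≡⟨ cong (_^ℚ k) y*c≡a ⟩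
    ℕ→ℚ a ^ℚ k             ≡⟨ ℕ→ℚ-^ a k ⟨
    ℕ→ℚ (a ^ k)            ∎
    where
    open ≡-Reasoning

  falling-shift : ∀ y N → falling (y + 1ℚ) (suc N) ≡ (y + 1ℚ) * falling y N
  falling-shift y zero =
    solve 1 (λ y → con 1ℚ :* ((y :+ con 1ℚ) :- con 0ℚ) := (y :+ con 1ℚ) :* con 1ℚ) refl y
  falling-shift y (suc N) = begin
    falling (y + 1ℚ) (suc N) * ((y + 1ℚ) - ℕ→ℚ (suc N))
      ≡⟨ cong₂ (λ f k → f * ((y + 1ℚ) - k)) (falling-shift y N) (ℕ→ℚ-+ 1 N) ⟩
    (y + 1ℚ) * falling y N * ((y + 1ℚ) - (1ℚ + ℕ→ℚ N))
      ≡⟨ lemma y (falling y N) (ℕ→ℚ N) ⟩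
    (y + 1ℚ) * (falling y N * (y - ℕ→ℚ N))
      ∎
    where
    open ≡-Reasoning
    lemma : ∀ y f k → (y + 1ℚ) * f * ((y + 1ℚ) - (1ℚ + k)) ≡ (y + 1ℚ) * (f * (y - k))
    lemma = solve 3 (λ y f k → (y :+ con 1ℚ) :* f :* ((y :+ con 1ℚ) :- (con 1ℚ :+ k))
                             := (y :+ con 1ℚ) :* (f :* (y :- k))) refl

  ℕ→ℚ-u : ∀ u0 r {x} → ℕ→ℚ r * x ≡ ℕ→ℚ u0 → ∀ j → ℕ→ℚ r * (x + ℕ→ℚ j) ≡ ℕ→ℚ (u u0 r j)
  ℕ→ℚ-u u0 r {x} r*x≡u0 j = begin
    ℕ→ℚ r * (x + ℕ→ℚ j)          ≡⟨ ℚP.*-distribˡ-+ (ℕ→ℚ r) x (ℕ→ℚ j) ⟩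
    ℕ→ℚ r * x + ℕ→ℚ r * ℕ→ℚ j    ≡⟨ cong₂ _+_ r*x≡u0 (ℚP.*-comm (ℕ→ℚ r) (ℕ→ℚ j)) ⟩
    ℕ→ℚ u0 + ℕ→ℚ j * ℕ→ℚ r       ≡⟨ cong (_+_ (ℕ→ℚ u0)) (ℕ→ℚ-* j r) ⟨
    ℕ→ℚ u0 + ℕ→ℚ (j ℕ.* r)       ≡⟨ ℕ→ℚ-+ u0 (j ℕ.* r) ⟨
    ℕ→ℚ (u u0 r j)               ∎
    where
    open ≡-Reasoning

  falling-∏u : ∀ u0 r {x} → ℕ→ℚ r * x ≡ ℕ→ℚ u0 → ∀ n →
    falling (x + ℕ→ℚ n) (suc n) * ℕ→ℚ (r ^ suc n) ≡ ℕ→ℚ (∏u u0 r n)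
  falling-∏u u0 r {x} r*x≡u0 zero = begin
    1ℚ * ((x + 0ℚ) - 0ℚ) * ℕ→ℚ (r ℕ.* 1)     ≡⟨ cong (1ℚ * ((x + 0ℚ) - 0ℚ) *_) (ℕ→ℚ-* r 1) ⟩
    1ℚ * ((x + 0ℚ) - 0ℚ) * (ℕ→ℚ r * 1ℚ)      ≡⟨ lemma (x + 0ℚ) (ℕ→ℚ r) ⟩
    ℕ→ℚ r * (x + 0ℚ)                          ≡⟨ ℕ→ℚ-u u0 r r*x≡u0 0 ⟩
    ℕ→ℚ (u u0 r 0)                            ∎
    where
    open ≡-Reasoning
    lemma : ∀ y c → 1ℚ * (y - 0ℚ) * (c * 1ℚ) ≡ c * y
    lemma = solve 2 (λ y c → con 1ℚ :* (y :- con 0ℚ) :* (c :* con 1ℚ) := c :* y) refl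
  falling-∏u u0 r {x} r*x≡u0 (suc n) = begin
    falling (x + ℕ→ℚ (suc n)) (2 ℕ.+ n) * ℕ→ℚ (r ^ (2 ℕ.+ n))
      ≡⟨ cong₂ (λ z c → falling z (2 ℕ.+ n) * c) x+[1+n]≡y+1 (ℕ→ℚ-* r (r ^ suc n)) ⟩
    falling (y + 1ℚ) (2 ℕ.+ n) * (ℕ→ℚ r * ℕ→ℚ (r ^ suc n))
      ≡⟨ cong (_* (ℕ→ℚ r * ℕ→ℚ (r ^ suc n))) (falling-shift y (suc n)) ⟩
    (y + 1ℚ) * falling y (suc n) * (ℕ→ℚ r * ℕ→ℚ (r ^ suc n))
      ≡⟨ interchange (y + 1ℚ) (falling y (suc n)) (ℕ→ℚ r) (ℕ→ℚ (r ^ suc n)) ⟩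
    (y + 1ℚ) * ℕ→ℚ r * (falling y (suc n) * ℕ→ℚ (r ^ suc n))
      ≡⟨ cong₂ _*_ [y+1]*r≡u[1+n] (falling-∏u u0 r r*x≡u0 n) ⟩
    ℕ→ℚ (u u0 r (suc n)) * ℕ→ℚ (∏u u0 r n)
      ≡⟨ ℕ→ℚ-* (u u0 r (suc n)) (∏u u0 r n) ⟨
    ℕ→ℚ (∏u u0 r (suc n))
      ∎
    where
    open ≡-Reasoning
    y : ℚ
    y = x + ℕ→ℚ n
    x+[1+n]≡y+1 : x + ℕ→ℚ (suc n) ≡ y + 1ℚ
    x+[1+n]≡y+1 = begin
      x + ℕ→ℚ (suc n)       ≡⟨ cong (_+_ x) (ℕ→ℚ-+ 1 n) ⟩
      x + (1ℚ + ℕ→ℚ n)      ≡⟨ cong (_+_ x) (ℚP.+-comm 1ℚ (ℕ→ℚ n)) ⟩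
      x + (ℕ→ℚ n + 1ℚ)      ≡⟨ ℚP.+-assoc x (ℕ→ℚ n) 1ℚ ⟨
      y + 1ℚ                ∎
    [y+1]*r≡u[1+n] : (y + 1ℚ) * ℕ→ℚ r ≡ ℕ→ℚ (u u0 r (suc n))
    [y+1]*r≡u[1+n] = begin
      (y + 1ℚ) * ℕ→ℚ r          ≡⟨ ℚP.*-comm (y + 1ℚ) (ℕ→ℚ r) ⟩
      ℕ→ℚ r * (y + 1ℚ)          ≡⟨ cong (ℕ→ℚ r *_) x+[1+n]≡y+1 ⟨
      ℕ→ℚ r * (x + ℕ→ℚ (suc n)) ≡⟨ ℕ→ℚ-u u0 r r*x≡u0 (suc n) ⟩
      ℕ→ℚ (u u0 r (suc n))      ∎

  binom-*-! : ∀ x N → binom x N * ℕ→ℚ (N !) ≡ falling x N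
  binom-*-! x N = begin
    falling x N * (+ 1 / N !) * ℕ→ℚ (N !)     ≡⟨ ℚP.*-assoc (falling x N) (+ 1 / N !) (ℕ→ℚ (N !)) ⟩
    falling x N * ((+ 1 / N !) * ℕ→ℚ (N !))   ≡⟨ cong (falling x N *_) (ℚP.*-comm (+ 1 / N !) (ℕ→ℚ (N !))) ⟩
    falling x N * (ℕ→ℚ (N !) * (+ 1 / N !))   ≡⟨ cong (falling x N *_) (ℕ→ℚ-*-/ (N !) 1) ⟩
    falling x N * 1ℚ                          ≡⟨ ℚP.*-identityʳ (falling x N) ⟩
    falling x N                               ∎
    where
    open ≡-Reasoning
    instance
      N!≢0 : NonZero (N !)
      N!≢0 = N ℕP.!≢0

  binom-∏u : ∀ u0 r n .{{_ : NonZero r}} →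
    binom ((+ u0) / r + ℕ→ℚ n) (suc n) * ℕ→ℚ (r ^ suc n ℕ.* suc n !) ≡ ℕ→ℚ (∏u u0 r n)
  binom-∏u u0 r n = begin
    B * ℕ→ℚ (r ^ suc n ℕ.* suc n !)           ≡⟨ cong (B *_) (ℕ→ℚ-* (r ^ suc n) (suc n !)) ⟩
    B * (ℕ→ℚ (r ^ suc n) * ℕ→ℚ (suc n !))     ≡⟨ ℚP.*-assoc B (ℕ→ℚ (r ^ suc n)) (ℕ→ℚ (suc n !)) ⟨
    B * ℕ→ℚ (r ^ suc n) * ℕ→ℚ (suc n !)       ≡⟨ xy∙z≈xz∙y B (ℕ→ℚ (r ^ suc n)) (ℕ→ℚ (suc n !)) ⟩
    B * ℕ→ℚ (suc n !) * ℕ→ℚ (r ^ suc n)       ≡⟨ cong (_* ℕ→ℚ (r ^ suc n)) (binom-*-! x+n (suc n)) ⟩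
    falling x+n (suc n) * ℕ→ℚ (r ^ suc n)     ≡⟨ falling-∏u u0 r (ℕ→ℚ-*-/ r u0) n ⟩
    ℕ→ℚ (∏u u0 r n)                           ∎
    where
    open ≡-Reasoning
    x+n B : ℚ
    x+n = (+ u0) / r + ℕ→ℚ n
    B = binom x+n (suc n)

open import Data.Nat using (ℕ; suc; _≥_; _*_; _∸_; _^_; NonZero)
open import Data.Nat.GCD using (gcd)
open import Data.Integer using (+_)
open import Data.Rational as ℚ using (ℚ; _/_; _≤_)
open import Relation.Binary.PropositionalEquality using (_≡_)
open import Data.Nat as ℕ using (_!; s≤s; >-nonZero)
open import Data.Nat.Properties using (m^n≢0; m*n≢0; _!≢0)
open import Data.Nat.Coprimality using (gcd≡1⇒coprime)
open import Data.Rational.Properties using (*-assoc)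
open import Relation.Binary.PropositionalEquality using (subst; cong; module ≡-Reasoning)
open OnNaturals using (∏u; ∏u-lcm-bound; ^-distribʳ-*)
open OnRationals using (ℕ→ℚ-^; ℕ→ℚ-*; ℕ→ℚ-cancelʳ-≤; ^ℚ-scaling; binom-∏u)

corollary4p1 : (u0 r n : ℕ) → .{{_ : NonZero r}} → u0 ≥ 1 → r ≥ 2 → gcd u0 r ≡ 1 →
    ℕ→ℚ (r ^ (n * r)) ℚ.* (binom ((+ u0) / r ℚ.+ ℕ→ℚ n) (suc n) ^ℚ (r ∸ 1))
      ≤ ℕ→ℚ (L u0 r n) ^ℚ (r ∸ 1)
corollary4p1 u0 r@(suc m) n u0≥1 (s≤s m≥1) gcd≡1 =
  subst (ℕ→ℚ K ℚ.* B ^ℚ m ≤_) (ℕ→ℚ-^ (L u0 r n) m)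
    (ℕ→ℚ-cancelʳ-≤ (K * P ^ m) (L u0 r n ^ m) (c ^ m) scaled bound)
  where
  open ≡-Reasoning
  K P c : ℕ
  K = r ^ (n * r)
  P = ∏u u0 r n
  c = r ^ suc n * suc n !
  B : ℚ
  B = binom ((+ u0) / r ℚ.+ ℕ→ℚ n) (suc n)
  instance
    c^m≢0 : NonZero (c ^ m)
    c^m≢0 = m^n≢0 c m {{m*n≢0 (r ^ suc n) (suc n !) {{m^n≢0 r (suc n)}} {{suc n !≢0}}}}
  scaled : ℕ→ℚ K ℚ.* B ^ℚ m ℚ.* ℕ→ℚ (c ^ m) ≡ ℕ→ℚ (K * P ^ m)
  scaled = begin
    ℕ→ℚ K ℚ.* B ^ℚ m ℚ.* ℕ→ℚ (c ^ m)    ≡⟨ *-assoc (ℕ→ℚ K) (B ^ℚ m) (ℕ→ℚ (c ^ m)) ⟩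
    ℕ→ℚ K ℚ.* (B ^ℚ m ℚ.* ℕ→ℚ (c ^ m))  ≡⟨ cong (ℕ→ℚ K ℚ.*_) (^ℚ-scaling P c m (binom-∏u u0 r n)) ⟩
    ℕ→ℚ K ℚ.* ℕ→ℚ (P ^ m)               ≡⟨ ℕ→ℚ-* K (P ^ m) ⟨
    ℕ→ℚ (K * P ^ m)                     ∎
  bound : K * P ^ m ℕ.≤ L u0 r n ^ m * c ^ m
  bound = subst (K * P ^ m ℕ.≤_) (^-distribʳ-* (L u0 r n) c m)
    (∏u-lcm-bound u0 m n {{>-nonZero u0≥1}} m≥1 (gcd≡1⇒coprime gcd≡1))
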